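{- For any tract $F$, the following are equivalent: (1) for every $a\in F-\{0\}$, $a\boxplus-a=F$; (2) $1\boxplus-1=F$; (3) for every $a\in F-\{0\}$ and $b\in F$, $a\in a\boxplus b$. Further, any hyperfield (viewed as a tract) having these properties satisfies the Inflation Property.
   Context: A tract is a multiplicative group $G$ with $N_G\subseteq\mathbb N[G]$ such that $0\in N_G$, $1\notin N_G$, there is a unique $\eta\in G$ with $1+\eta\in N_G$, and $N_G$ is closed under multiplication by $G$; $F=G\cup\{0\}$, $-g:=\eta g$, $-0=0$, and for $a_1,\dots,a_k\in F$, $a_1\boxplus\cdots\boxplus a_k:=\{b\in F: -b+\sum_ja_j\in N_G\}$ (zero terms dropped from formal sums). A hyperfield is a set $R$ with elements $0\neq1$, a multiplication making $R-\{0\}$ a commutative group with $0\cdot x=0$, and a commutative associative hyperoperation $\boxplus$ (values nonempty subsets) with $0\boxplus x=\{x\}$, unique additive inverses $-x$ with $0\in x\boxplus-x$, reversibility ($x\in y\boxplus z\iff z\in x\boxplus-y$) and distributivity $a(x\boxplus y)=ax\boxplus ay$; it is a tract with $G=R-\{0\}$ and $N_G=\{\sum a_j: 0\in\boxplus_ja_j\}$. A tract has the Inflation Property if whenever $\sum_{j=1}^ka_j\in N_G-\{0\}$ we have $b+\sum_{j=1}^ka_j\in N_G$ for all $b\in G$. -}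

module Defs where

open import Data.List using (List; []; _∷_; map; catMaybes)
open import Data.List.Relation.Binary.Permutation.Propositional using (_↭_)
open import Data.Maybe using (Maybe; just; nothing)
open import Data.Product using (Σ; ∃; _×_; _,_)
open import Data.Empty using (⊥)
open import Relation.Nullary using (¬_)
open import Relation.Binary.PropositionalEquality using (_≡_; _≢_; refl; subst; sym)
open import Function.Bundles using (_⇔_)

-- Tracts.
-- ℕ[G] (the free commutative monoid / semiring additive part on G) is
-- represented by lists of elements of G taken up to permutation; N_G is
-- a predicate on lists that is required to be permutation invariant.
-- The empty list is the formal sum 0.

record PreTract : Set₁ where
  field
    G   : Set
    _·_ : G → G → G
    1g  : G
    η   : G
    N   : List G → Set

record Tract : Set₁ where
  field
    G        : Set
    _·_      : G → G → G
    1g       : G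
    _⁻¹      : G → G
    ·-assoc  : ∀ x y z → (x · y) · z ≡ x · (y · z)
    ·-comm   : ∀ x y → x · y ≡ y · x
    ·-identityˡ : ∀ x → 1g · x ≡ x
    ·-inverseˡ  : ∀ x → (x ⁻¹) · x ≡ 1g
    N        : List G → Set
    N-perm   : ∀ {xs ys} → xs ↭ ys → N xs → N ys
    0∈N      : N []
    1∉N      : ¬ N (1g ∷ [])
    η        : G
    η-spec   : N (1g ∷ η ∷ [])
    η-unique : ∀ e → N (1g ∷ e ∷ []) → e ≡ η
    N-mul    : ∀ g xs → N xs → N (map (g ·_) xs)

toPre : Tract → PreTract
toPre T = record { G = G ; _·_ = _·_ ; 1g = 1g ; η = η ; N = N }
  where open Tract T

module PT (T : PreTract) where
  open PreTract T

  -- F = G ∪ {0}, with 0 represented by nothing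
  F : Set
  F = Maybe G

  -_ : F → F
  - nothing = nothing
  - just g  = just (η · g)

  formal : List F → List G
  formal = catMaybes

  _∈⊞_ : F → List F → Set
  b ∈⊞ as = N (formal ((- b) ∷ as))

  Prop1 : Set
  Prop1 = ∀ (a : G) (b : F) → b ∈⊞ (just a ∷ (- just a) ∷ [])

  Prop2 : Set
  Prop2 = ∀ (b : F) → b ∈⊞ (just 1g ∷ (- just 1g) ∷ [])

  Prop3 : Set
  Prop3 = ∀ (a : G) (b : F) → just a ∈⊞ (just a ∷ b ∷ [])

  Inflation : Set
  Inflation = ∀ (as : List G) → N as → as ≢ [] → ∀ (b : G) → N (b ∷ as)

record Hyperfield : Set₁ where
  field
    R    : Set
    0r   : R
    1r   : R
    _*_  : R → R → R
    _∈_⊞_ : R → R → R → Set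
    -_   : R → R
    0≢1  : 0r ≢ 1r
    *-assoc     : ∀ x y z → (x * y) * z ≡ x * (y * z)
    *-comm      : ∀ x y → x * y ≡ y * x
    *-identityˡ : ∀ x → 1r * x ≡ x
    *-nonzero   : ∀ {x y} → x ≢ 0r → y ≢ 0r → x * y ≢ 0r
    *-inverse   : ∀ x → x ≢ 0r → Σ R λ y → (y ≢ 0r) × (y * x ≡ 1r)
    zeroˡ       : ∀ x → 0r * x ≡ 0r
    ⊞-nonempty  : ∀ x y → Σ R λ z → z ∈ x ⊞ y
    ⊞-comm      : ∀ {x y z} → z ∈ x ⊞ y → z ∈ y ⊞ x
    ⊞-assoc     : ∀ x y z w →
                  (Σ R λ u → (u ∈ x ⊞ y) × (w ∈ u ⊞ z)) ⇔
                  (Σ R λ v → (v ∈ y ⊞ z) × (w ∈ x ⊞ v))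
    ⊞-identityˡ : ∀ x z → (z ∈ 0r ⊞ x) ⇔ (z ≡ x)
    -inverse    : ∀ x → 0r ∈ x ⊞ (- x)
    -unique     : ∀ x y → 0r ∈ x ⊞ y → y ≡ - x
    reversible  : ∀ x y z → (x ∈ y ⊞ z) ⇔ (z ∈ x ⊞ (- y))
    distrib     : ∀ a x y z → (z ∈ (a * x) ⊞ (a * y)) ⇔
                  (Σ R λ w → (w ∈ x ⊞ y) × (z ≡ a * w))

module HF (H : Hyperfield) where
  open Hyperfield H

  -- nonzero elements (proof of nonzeroness irrelevant, so equality is on values)
  record NZ : Set where
    constructor nz
    field
      val    : R
      .val≢0 : val ≢ 0r
  open NZ

  _∈⊞L_ : R → List R → Set
  x ∈⊞L []       = x ≡ 0r
  x ∈⊞L (a ∷ as) = Σ R λ y → (y ∈⊞L as) × (x ∈ a ⊞ y)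

  -1≢0 : - 1r ≢ 0r
  -1≢0 e = 0≢1 (Function.Bundles.Equivalence.to (⊞-identityˡ 1r 0r)
             (⊞-comm (subst (λ t → 0r ∈ 1r ⊞ t) e (-inverse 1r))))

  mulNZ : NZ → NZ → NZ
  mulNZ (nz x p) (nz y q) = nz (x * y) (*-nonzero p q)

  -- the tract associated to H: G = H - {0}, N_G = {Σ aⱼ : 0 ∈ ⊞ aⱼ},
  -- η = -1 (the unique element with 0 ∈ 1 ⊞ η)
  tractOf : PreTract
  tractOf = record
    { G   = NZ
    ; _·_ = mulNZ
    ; 1g  = nz 1r (λ e → 0≢1 (sym e))
    ; η   = nz (- 1r) -1≢0
    ; N   = λ xs → 0r ∈⊞L map val xs
    }

module Submission where

-- In a tract, membership in an iterated hypersum is invariant under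
-- scaling all terms by g ∈ G, and, because η² = 1, satisfies the
-- reversibility law  x ∈ y ⊞ z ⇒ z ∈ x ⊞ -y.  Scaling by a carries
-- 1 ⊞ -1 onto a ⊞ -a, which gives (1) ⇔ (2); reversibility turns
-- a ∈ a ⊞ b into b ∈ a ⊞ -a, which gives (1) ⇔ (3).  In a hyperfield,
-- if 0 ∈ a ⊞ s then s = -a, and (1) puts -b into a ⊞ -a, so
-- 0 ∈ b ⊞ a ⊞ s.

open import Defs
open import Data.Product using (_×_; _,_)
open import Data.List using (List; []; _∷_; map)
open import Data.List.Properties using (map-cong; map-catMaybes)
open import Data.List.Relation.Binary.Permutation.Propositional using (_↭_; refl; prep; swap)
open import Data.List.Relation.Binary.Permutation.Propositional.Properties using (catMaybes-↭; shift)
open import Data.Maybe as Maybe using (just; nothing)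
open import Data.Empty using (⊥-elim)
open import Relation.Binary.PropositionalEquality
  using (_≡_; refl; sym; trans; cong; cong₂; subst; subst₂; module ≡-Reasoning)
open import Function.Bundles using (Equivalence)

module TractProperties (T : Tract) where
  open Tract T
  open PT (toPre T)

  ·-identityʳ : ∀ x → x · 1g ≡ x
  ·-identityʳ x = trans (·-comm x 1g) (·-identityˡ x)

  ·-inverseʳ : ∀ x → x · (x ⁻¹) ≡ 1g
  ·-inverseʳ x = trans (·-comm x (x ⁻¹)) (·-inverseˡ x)

  η⁻¹≡η : η ⁻¹ ≡ η
  η⁻¹≡η = η-unique (η ⁻¹) (N-perm (swap _ _ refl) (subst N scaled (N-mul (η ⁻¹) _ η-spec)))
    where
      scaled : map ((η ⁻¹) ·_) (1g ∷ η ∷ []) ≡ η ⁻¹ ∷ 1g ∷ []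
      scaled = cong₂ _∷_ (·-identityʳ (η ⁻¹)) (cong (_∷ []) (·-inverseˡ η))

  η·η≡1 : η · η ≡ 1g
  η·η≡1 = subst (λ e → e · η ≡ 1g) η⁻¹≡η (·-inverseˡ η)

  infixr 7 _⊙_
  _⊙_ : G → F → F
  g ⊙ x = Maybe.map (g ·_) x

  ⊙-assoc : ∀ g h x → g ⊙ (h ⊙ x) ≡ (g · h) ⊙ x
  ⊙-assoc g h nothing  = refl
  ⊙-assoc g h (just x) = cong just (sym (·-assoc g h x))

  ⊙-identityˡ : ∀ x → 1g ⊙ x ≡ x
  ⊙-identityˡ nothing  = refl
  ⊙-identityˡ (just x) = cong just (·-identityˡ x)

  ⊙-cancelˡ : ∀ g x → g ⊙ (g ⁻¹ ⊙ x) ≡ x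
  ⊙-cancelˡ g x = begin
    g ⊙ (g ⁻¹ ⊙ x)  ≡⟨ ⊙-assoc g (g ⁻¹) x ⟩
    (g · (g ⁻¹)) ⊙ x  ≡⟨ cong (_⊙ x) (·-inverseʳ g) ⟩
    1g ⊙ x          ≡⟨ ⊙-identityˡ x ⟩
    x               ∎
    where open ≡-Reasoning

  -‿≡η⊙ : ∀ x → - x ≡ η ⊙ x
  -‿≡η⊙ nothing  = refl
  -‿≡η⊙ (just x) = refl

  ⊙-neg : ∀ g x → g ⊙ (- x) ≡ - (g ⊙ x)
  ⊙-neg g x = begin
    g ⊙ (- x)    ≡⟨ cong (g ⊙_) (-‿≡η⊙ x) ⟩
    g ⊙ (η ⊙ x)  ≡⟨ ⊙-assoc g η x ⟩
    (g · η) ⊙ x  ≡⟨ cong (_⊙ x) (·-comm g η) ⟩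
    (η · g) ⊙ x  ≡⟨ ⊙-assoc η g x ⟨
    η ⊙ (g ⊙ x)  ≡⟨ -‿≡η⊙ (g ⊙ x) ⟨
    - (g ⊙ x)    ∎
    where open ≡-Reasoning

  -‿involutive : ∀ x → - (- x) ≡ x
  -‿involutive x = begin
    - (- x)      ≡⟨ cong -_ (-‿≡η⊙ x) ⟩
    - (η ⊙ x)    ≡⟨ -‿≡η⊙ (η ⊙ x) ⟩
    η ⊙ (η ⊙ x)  ≡⟨ ⊙-assoc η η x ⟩
    (η · η) ⊙ x  ≡⟨ cong (_⊙ x) η·η≡1 ⟩
    1g ⊙ x       ≡⟨ ⊙-identityˡ x ⟩
    x            ∎
    where open ≡-Reasoning

  Null : List F → Set
  Null xs = N (formal xs)

  Null-↭ : ∀ {xs ys} → xs ↭ ys → Null xs → Null ys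
  Null-↭ p = N-perm (catMaybes-↭ p)

  Null-⊙ : ∀ g xs → Null xs → Null (map (g ⊙_) xs)
  Null-⊙ g xs n = subst N (map-catMaybes (g ·_) xs) (N-mul g (formal xs) n)

  Null-neg : ∀ xs → Null xs → Null (map -_ xs)
  Null-neg xs n = subst Null (map-cong (λ x → sym (-‿≡η⊙ x)) xs) (Null-⊙ η xs n)

  ∈⊞-⊙ : ∀ g x ys → x ∈⊞ ys → (g ⊙ x) ∈⊞ map (g ⊙_) ys
  ∈⊞-⊙ g x ys x∈ys =
    subst (λ w → Null (w ∷ map (g ⊙_) ys)) (⊙-neg g x) (Null-⊙ g (- x ∷ ys) x∈ys)

  ∈⊞-comm : ∀ x y z → x ∈⊞ (y ∷ z ∷ []) → x ∈⊞ (z ∷ y ∷ [])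
  ∈⊞-comm x y z = Null-↭ (prep (- x) (swap y z (refl {xs = []})))

  ∈⊞-reverse : ∀ x y z → x ∈⊞ (y ∷ z ∷ []) → z ∈⊞ (x ∷ - y ∷ [])
  ∈⊞-reverse x y z x∈y⊞z =
    Null-↭ (shift (- z) (x ∷ - y ∷ []) [])
      (subst (λ w → Null (w ∷ - y ∷ - z ∷ [])) (-‿involutive x)
        (Null-neg (- x ∷ y ∷ z ∷ []) x∈y⊞z))

  prop1⇒prop2 : Prop1 → Prop2
  prop1⇒prop2 h = h 1g

  prop2⇒prop1 : Prop2 → Prop1
  prop2⇒prop1 h a b =
    subst₂ _∈⊞_ (⊙-cancelˡ a b) a⊙[1⊞-1]≡a⊞-a
      (∈⊞-⊙ a (a ⁻¹ ⊙ b) (just 1g ∷ - just 1g ∷ []) (h (a ⁻¹ ⊙ b)))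
    where
      a⊙[1⊞-1]≡a⊞-a : map (a ⊙_) (just 1g ∷ - just 1g ∷ []) ≡ just a ∷ - just a ∷ []
      a⊙[1⊞-1]≡a⊞-a = trans (cong (λ w → a ⊙ just 1g ∷ w ∷ []) (⊙-neg a (just 1g)))
                            (cong (λ u → u ∷ - u ∷ []) (cong just (·-identityʳ a)))

  prop1⇒prop3 : Prop1 → Prop3
  prop1⇒prop3 h a b =
    ∈⊞-comm (just a) b (just a)
      (subst (λ w → just a ∈⊞ (b ∷ w ∷ [])) (-‿involutive (just a))
        (∈⊞-reverse b (- just a) (just a) (∈⊞-comm b (just a) (- just a) (h a b))))

  prop3⇒prop1 : Prop3 → Prop1
  prop3⇒prop1 h a b = ∈⊞-reverse (just a) (just a) b (h a b)

module HyperfieldProperties (H : Hyperfield) where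
  open Hyperfield H
  open HF H
  open NZ
  open PT tractOf using (Prop1; Inflation)

  ⊞-identityʳ : ∀ {x z} → z ∈ x ⊞ 0r → z ≡ x
  ⊞-identityʳ {x} {z} z∈x⊞0 = Equivalence.to (⊞-identityˡ x z) (⊞-comm z∈x⊞0)

  -‿involutive : ∀ x → - (- x) ≡ x
  -‿involutive x = sym (-unique (- x) x (⊞-comm (-inverse x)))

  -1*x≡-x : ∀ x → (- 1r) * x ≡ - x
  -1*x≡-x x = trans (*-comm (- 1r) x) (-unique x (x * (- 1r)) 0∈x⊞x*-1)
    where
      0∈x⊞x*-1 : 0r ∈ x ⊞ (x * (- 1r))
      0∈x⊞x*-1 = subst (λ t → 0r ∈ t ⊞ (x * (- 1r))) (trans (*-comm x 1r) (*-identityˡ x))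
        (Equivalence.from (distrib x 1r (- 1r) 0r)
          (0r , -inverse 1r , sym (trans (*-comm x 0r) (zeroˡ x))))

  ∈⊞L-singleton : ∀ {x y} → y ∈⊞L (x ∷ []) → y ≡ x
  ∈⊞L-singleton (z , z≡0 , y∈x⊞z) = ⊞-identityʳ (subst (λ t → _ ∈ _ ⊞ t) z≡0 y∈x⊞z)

  -b∈a⊞-a : Prop1 → (a b : NZ) → (- val b) ∈ val a ⊞ (- val a)
  -- (1) applied to the element -b of the tract, whose η is -1.
  -b∈a⊞-a p1 a b with p1 a (just (mulNZ (PreTract.η tractOf) b))
  ... | y , (y′ , y′∈⊞L-a , y∈a⊞y′) , 0∈b⊞y =
    subst₂ (λ u v → u ∈ val a ⊞ v) y≡-b y′≡-a y∈a⊞y′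
    where
      y′≡-a : y′ ≡ - val a
      y′≡-a = trans (∈⊞L-singleton y′∈⊞L-a) (-1*x≡-x (val a))

      -1*-1*b≡b : (- 1r) * ((- 1r) * val b) ≡ val b
      -1*-1*b≡b = trans (-1*x≡-x _) (trans (cong -_ (-1*x≡-x (val b))) (-‿involutive (val b)))

      y≡-b : y ≡ - val b
      y≡-b = -unique (val b) y (subst (λ t → 0r ∈ t ⊞ y) -1*-1*b≡b 0∈b⊞y)

  inflation : Prop1 → Inflation
  inflation p1 []       _                     []≢[] b = ⊥-elim ([]≢[] refl)
  inflation p1 (a ∷ as) (s , s∈⊞as , 0∈a⊞s) _     b =
    - val b , (s , s∈⊞as , -b∈a⊞s) , -inverse (val b)
    where
      -b∈a⊞s : (- val b) ∈ val a ⊞ s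
      -b∈a⊞s = subst (λ t → (- val b) ∈ val a ⊞ t) (sym (-unique (val a) s 0∈a⊞s))
                 (-b∈a⊞-a p1 a b)

proposition7p10 : (∀ (T : Tract) → let open PT (toPre T) in
    (Prop1 → Prop2) × (Prop2 → Prop3) × (Prop3 → Prop1))
    × (∀ (H : Hyperfield) → let open PT (HF.tractOf H) in
    Prop1 × Prop2 × Prop3 → Inflation)
proposition7p10 = tract-part , hyperfield-part
  where
    tract-part : ∀ (T : Tract) → let open PT (toPre T) in
      (Prop1 → Prop2) × (Prop2 → Prop3) × (Prop3 → Prop1)
    tract-part T = prop1⇒prop2 , (λ p2 → prop1⇒prop3 (prop2⇒prop1 p2)) , prop3⇒prop1
      where open TractProperties T

    hyperfield-part : ∀ (H : Hyperfield) → let open PT (HF.tractOf H) in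
      Prop1 × Prop2 × Prop3 → Inflation
    hyperfield-part H (p1 , _ , _) = HyperfieldProperties.inflation H p1
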